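{- Let $w_1$ be a binary word starting with $0$ and having at least $3$ runs. A circular permutation $[\tau]$ is contained in $[G(w_1)]$ if and only if $[\tau] = [G(w_2)]$ for some binary word $w_2$ starting with $0$ such that $w_2$ or its complement $w_2^c$ is a subsequence of $w_1$.
   Context: A run of a binary word is a maximal block of consecutive equal letters; the complement $w^c$ of a binary word swaps all $0$s and $1$s; subsequences need not be contiguous. For a binary word $w=w_1\cdots w_n$ starting with $0$ with at least $3$ runs, $G(w)$ is the permutation of $[n]$ with exactly one descent such that, for each $i$, $w_i=0$ iff the value $n-i+1$ appears after the descent; if $w$ starts with $0$ and has at most $2$ runs, $G(w)=12\cdots n$. A circular permutation $[\pi]$ is the set of all rotations of $\pi$; $[\sigma]$ contains $[\pi]$ if some rotation of $\sigma$ has a subsequence order-isomorphic to $\pi$. -}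

module Defs where

open import Data.Bool using (Bool; true; false; not)
open import Data.Bool.Properties using () renaming (_≟_ to _≟B_)
open import Data.Empty using (⊥)
open import Relation.Nullary using (yes; no)
open import Data.Nat using (ℕ; zero; suc; _+_; _<_; _≤_; _≤?_)
open import Data.List using (List; []; _∷_; _++_; length; drop; take; map; reverse; upTo; lookup)
open import Data.Product using (Σ; _×_; _,_; ∃)
open import Data.Fin using (Fin; cast)
open import Data.List.Relation.Binary.Sublist.Propositional using (_⊆_)
open import Data.List.Relation.Binary.Permutation.Propositional using (_↭_)
open import Relation.Binary.PropositionalEquality using (_≡_)
open import Function.Bundles using (_⇔_)

-- Binary words: letter 0 is 'false', letter 1 is 'true'.
Word : Set
Word = List Bool

StartsWith0 : Word → Set
StartsWith0 []      = ⊥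
StartsWith0 (b ∷ _) = b ≡ false

runsFrom : Bool → Word → ℕ
runsFrom b []       = 0
runsFrom b (c ∷ cs) with b ≟B c
... | yes _ = runsFrom c cs
... | no  _ = suc (runsFrom c cs)

runs : Word → ℕ
runs []       = 0
runs (b ∷ bs) = suc (runsFrom b bs)

complement : Word → Word
complement = map not

-- Permutations are lists of values; a permutation of [n] is a list
-- that is a rearrangement of 1,2,...,n.
IsPerm : List ℕ → Set
IsPerm π = π ↭ map suc (upTo (length π))

split : ℕ → Word → List ℕ × List ℕ
split k []           = [] , []
split k (true ∷ bs)  with split (suc k) bs
... | a , b = k ∷ a , b
split k (false ∷ bs) with split (suc k) bs
... | a , b = a , k ∷ b

-- For w = w_1 ... w_n, value v ∈ [n] corresponds to letter w_{n-v+1},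
-- which is the v-th letter of reverse w.  The permutation with exactly one
-- descent whose post-descent values are exactly {n-i+1 : w_i = 0} is
-- (increasing list of the other values) ++ (increasing list of these values).
oneDescentPerm : Word → List ℕ
oneDescentPerm w with split 1 (reverse w)
... | a , b = a ++ b

identityPerm : ℕ → List ℕ
identityPerm n = map suc (upTo n)

G : Word → List ℕ
G w with 3 ≤? runs w
... | yes _ = oneDescentPerm w
... | no  _ = identityPerm (length w)

rotate : ℕ → List ℕ → List ℕ
rotate k xs = drop k xs ++ take k xs

OrderIso : List ℕ → List ℕ → Set
OrderIso xs ys =
  Σ (length xs ≡ length ys) λ eq →
    ∀ (i j : Fin (length xs)) →
      (lookup xs i < lookup xs j) ⇔ (lookup ys (cast eq i) < lookup ys (cast eq j))

CircContains : List ℕ → List ℕ → Set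
CircContains σ π = ∃ λ k → ∃ λ s → (s ⊆ rotate k σ) × OrderIso s π

CircEq : List ℕ → List ℕ → Set
CircEq τ π = ∃ λ k → τ ≡ rotate k π

module Submission where

-- A subsequence of oneDescentPerm w is, up to an order-preserving relabelling of its
-- values, oneDescentPerm u for a subword u of w, and conversely every subword yields such
-- a subsequence.  Relabelling commutes with rotation, and the subsequences of rotations of
-- σ are exactly the rotations of subsequences of σ.  Since two order-isomorphic
-- permutations of [n] coincide (each value is one more than the number of smaller ones),
-- [τ] ≤ [oneDescentPerm w₁] iff [τ] = [oneDescentPerm u] for a subword u of w₁.  Finally
-- complementing u swaps the two increasing blocks of oneDescentPerm u, which is a rotation,
-- so u may be taken to start with 0, where oneDescentPerm agrees with G.

open import Defs
open import Data.Bool using (true; false; not)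
open import Data.Bool.Properties using (not-involutive)
open import Data.Empty using (⊥-elim)
open import Data.Fin using (cast) renaming (zero to fzero; suc to fsuc)
open import Data.List
  using (List; []; _∷_; _++_; length; map; reverse; replicate; take; drop; filter; lookup; applyUpTo)
open import Data.List.Properties
  using (∷-injective; ++-assoc; take++drop≡id; map-++; map-∘; map-cong; map-id; map-cong-local;
         map-applyUpTo; length-map; take-map; drop-map; filter-accept; filter-reject; filter-none;
         reverse-++; reverse-map; reverse-involutive; unfold-reverse; length-reverse)
open import Data.List.Membership.Propositional using (_∈_)
open import Data.List.Membership.Propositional.Properties using (∈-lookup)
open import Data.List.Relation.Unary.All as All using (All; []; _∷_)
open import Data.List.Relation.Unary.Any using (here; there)
open import Data.List.Relation.Binary.Sublist.Propositional using (_⊆_; []; _∷_; _∷ʳ_)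
open import Data.List.Relation.Binary.Sublist.Propositional.Properties using (++⁺; reverse⁺)
open import Data.List.Relation.Binary.Permutation.Propositional using (_↭_; prep; ↭-refl; ↭-trans; ↭-reflexive)
open import Data.List.Relation.Binary.Permutation.Propositional.Properties
  using (shift; ++-comm; ↭-length; filter-↭; ∈-resp-↭)
open import Data.Nat using (ℕ; zero; suc; _+_; _≤_; _<_; s≤s⁻¹; _≤?_; _<?_)
open import Data.Nat.Properties
  using (≤-refl; <⇒≤; ≤⇒≯; ≰⇒>; <-irrefl; <-trans; ≤-<-trans; <-≤-trans; <-cmp;
         +-suc; +-identityʳ; m≤n+m; +-monoˡ-<; n≤0⇒n≡0; suc-injective)
open import Data.Product using (_×_; _,_; ∃; ∃₂; proj₁; proj₂)
open import Data.Sum using (_⊎_; inj₁; inj₂)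
open import Function using (_∘_)
open import Function.Bundles using (_⇔_; mk⇔; Equivalence)
open import Relation.Binary.Definitions using (tri<; tri≈; tri>)
open import Relation.Binary.PropositionalEquality
  using (_≡_; refl; sym; trans; cong; cong₂; subst; subst₂; module ≡-Reasoning)
open import Relation.Nullary using (yes; no)

range : ℕ → ℕ → List ℕ
range k zero    = []
range k (suc n) = k ∷ range (suc k) n

range-≥ : ∀ k n → All (k ≤_) (range k n)
range-≥ k zero    = []
range-≥ k (suc n) = ≤-refl ∷ All.map <⇒≤ (range-≥ (suc k) n)

applyUpTo≡range : ∀ (f : ℕ → ℕ) k n → (∀ i → f i ≡ k + i) → applyUpTo f n ≡ range k n
applyUpTo≡range f k zero    _ = refl
applyUpTo≡range f k (suc n) f≗k+ =
  cong₂ _∷_ (trans (f≗k+ 0) (+-identityʳ k))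
            (applyUpTo≡range (f ∘ suc) (suc k) n (λ i → trans (f≗k+ (suc i)) (+-suc k i)))

identityPerm≡range : ∀ n → identityPerm n ≡ range 1 n
identityPerm≡range n = trans (map-applyUpTo (λ i → i) suc n) (applyUpTo≡range suc 1 n (λ _ → refl))

↭-range-≥ : ∀ {xs k n} → xs ↭ range k n → All (k ≤_) xs
↭-range-≥ {k = k} {n} xs↭ = All.tabulate (λ x∈ → All.lookup (range-≥ k n) (∈-resp-↭ xs↭ x∈))

IsPerm⇒↭range : ∀ {τ} → IsPerm τ → τ ↭ range 1 (length τ)
IsPerm⇒↭range {τ} = subst (τ ↭_) (identityPerm≡range (length τ))

module _ {A : Set} where

  take-length-++ : ∀ (xs ys : List A) → take (length xs) (xs ++ ys) ≡ xs
  take-length-++ []       ys = refl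
  take-length-++ (x ∷ xs) ys = cong (x ∷_) (take-length-++ xs ys)

  drop-length-++ : ∀ (xs ys : List A) → drop (length xs) (xs ++ ys) ≡ ys
  drop-length-++ []       ys = refl
  drop-length-++ (x ∷ xs) ys = drop-length-++ xs ys

  ++-≡-++ : ∀ (xs₁ xs₂ ys₁ ys₂ : List A) → xs₁ ++ xs₂ ≡ ys₁ ++ ys₂ →
    (∃ λ c → xs₁ ≡ ys₁ ++ c × ys₂ ≡ c ++ xs₂) ⊎ (∃ λ c → ys₁ ≡ xs₁ ++ c × xs₂ ≡ c ++ ys₂)
  ++-≡-++ xs₁       xs₂ []        ys₂ e = inj₁ (xs₁ , refl , sym e)
  ++-≡-++ []        xs₂ (y ∷ ys₁) ys₂ e = inj₂ (y ∷ ys₁ , refl , e)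
  ++-≡-++ (x ∷ xs₁) xs₂ (y ∷ ys₁) ys₂ e with ∷-injective e
  ... | refl , e′ with ++-≡-++ xs₁ xs₂ ys₁ ys₂ e′
  ... | inj₁ (c , refl , e″) = inj₁ (c , refl , e″)
  ... | inj₂ (c , refl , e″) = inj₂ (c , refl , e″)

  ⊆-++⁻ : ∀ (xs ys : List A) {zs} → zs ⊆ xs ++ ys →
    ∃₂ λ zs₁ zs₂ → zs ≡ zs₁ ++ zs₂ × zs₁ ⊆ xs × zs₂ ⊆ ys
  ⊆-++⁻ []       ys p = [] , _ , refl , [] , p
  ⊆-++⁻ (x ∷ xs) ys (.x ∷ʳ p) with ⊆-++⁻ xs ys p
  ... | zs₁ , zs₂ , refl , p₁ , p₂ = zs₁ , zs₂ , refl , x ∷ʳ p₁ , p₂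
  ⊆-++⁻ (x ∷ xs) ys (x≡z ∷ p) with ⊆-++⁻ xs ys p
  ... | zs₁ , zs₂ , refl , p₁ , p₂ = _ ∷ zs₁ , zs₂ , refl , x≡z ∷ p₁ , p₂

  ++-⊆⁻ : ∀ (xs ys : List A) {zs} → xs ++ ys ⊆ zs →
    ∃₂ λ zs₁ zs₂ → zs ≡ zs₁ ++ zs₂ × xs ⊆ zs₁ × ys ⊆ zs₂
  ++-⊆⁻ []       ys p = [] , _ , refl , [] , p
  ++-⊆⁻ (x ∷ xs) ys (z ∷ʳ p) with ++-⊆⁻ (x ∷ xs) ys p
  ... | zs₁ , zs₂ , refl , p₁ , p₂ = z ∷ zs₁ , zs₂ , refl , z ∷ʳ p₁ , p₂
  ++-⊆⁻ (x ∷ xs) ys (x≡z ∷ p) with ++-⊆⁻ xs ys p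
  ... | zs₁ , zs₂ , refl , p₁ , p₂ = _ ∷ zs₁ , zs₂ , refl , x≡z ∷ p₁ , p₂

  lookup-map : ∀ {B : Set} (f : A → B) xs i → lookup (map f xs) i ≡ f (lookup xs (cast (length-map f xs) i))
  lookup-map f (x ∷ xs) fzero    = refl
  lookup-map f (x ∷ xs) (fsuc i) = lookup-map f xs i

  lookup-ext : ∀ {n} (xs ys : List A) (e₁ : n ≡ length xs) (e₂ : n ≡ length ys) →
    (∀ i → lookup xs (cast e₁ i) ≡ lookup ys (cast e₂ i)) → xs ≡ ys
  lookup-ext []       []       refl _  _  = refl
  lookup-ext (x ∷ xs) (y ∷ ys) refl e₂ eq =
    cong₂ _∷_ (eq fzero) (lookup-ext xs ys refl (suc-injective e₂) (eq ∘ fsuc))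

  replicate-∷ʳ : ∀ n (x : A) → replicate n x ++ x ∷ [] ≡ x ∷ replicate n x
  replicate-∷ʳ zero    x = refl
  replicate-∷ʳ (suc n) x = cong (x ∷_) (replicate-∷ʳ n x)

  reverse-replicate : ∀ n (x : A) → reverse (replicate n x) ≡ replicate n x
  reverse-replicate zero    x = refl
  reverse-replicate (suc n) x = begin
    reverse (x ∷ replicate n x)      ≡⟨ unfold-reverse x (replicate n x) ⟩
    reverse (replicate n x) ++ x ∷ [] ≡⟨ cong (_++ x ∷ []) (reverse-replicate n x) ⟩
    replicate n x ++ x ∷ []          ≡⟨ replicate-∷ʳ n x ⟩
    x ∷ replicate n x                ∎
    where open ≡-Reasoning

rotate-++ : ∀ xs ys → rotate (length xs) (xs ++ ys) ≡ ys ++ xs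
rotate-++ xs ys = cong₂ _++_ (drop-length-++ xs ys) (take-length-++ xs ys)

rotate-map : ∀ (f : ℕ → ℕ) k xs → rotate k (map f xs) ≡ map f (rotate k xs)
rotate-map f k xs = begin
  drop k (map f xs) ++ take k (map f xs)   ≡⟨ cong₂ _++_ (drop-map k xs) (take-map k xs) ⟩
  map f (drop k xs) ++ map f (take k xs)   ≡⟨ map-++ f (drop k xs) (take k xs) ⟨
  map f (rotate k xs)                      ∎
  where open ≡-Reasoning

rotate-↭ : ∀ k xs → rotate k xs ↭ xs
rotate-↭ k xs = ↭-trans (++-comm (drop k xs) (take k xs)) (↭-reflexive (take++drop≡id k xs))

++-swap-rotate : ∀ xs ys zs₁ zs₂ → zs₁ ++ zs₂ ≡ ys ++ xs → ∃ λ k → zs₂ ++ zs₁ ≡ rotate k (xs ++ ys)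
++-swap-rotate xs ys zs₁ zs₂ e with ++-≡-++ zs₁ zs₂ ys xs e
... | inj₁ (c , refl , refl) = length c , (begin
  zs₂ ++ ys ++ c
    ≡⟨ ++-assoc zs₂ ys c ⟨
  (zs₂ ++ ys) ++ c
    ≡⟨ rotate-++ c (zs₂ ++ ys) ⟨
  rotate (length c) (c ++ zs₂ ++ ys)
    ≡⟨ cong (rotate (length c)) (++-assoc c zs₂ ys) ⟨
  rotate (length c) ((c ++ zs₂) ++ ys) ∎)
  where open ≡-Reasoning
... | inj₂ (c , refl , refl) = length (xs ++ zs₁) , (begin
  (c ++ xs) ++ zs₁
    ≡⟨ ++-assoc c xs zs₁ ⟩
  c ++ xs ++ zs₁
    ≡⟨ rotate-++ (xs ++ zs₁) c ⟨
  rotate (length (xs ++ zs₁)) ((xs ++ zs₁) ++ c)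
    ≡⟨ cong (rotate (length (xs ++ zs₁))) (++-assoc xs zs₁ c) ⟩
  rotate (length (xs ++ zs₁)) (xs ++ zs₁ ++ c) ∎)
  where open ≡-Reasoning

CircEq-trans : ∀ {xs ys zs} → CircEq xs ys → CircEq ys zs → CircEq xs zs
CircEq-trans {zs = zs} (m , refl) (j , refl) =
  let ys = rotate j zs
      k , e = ++-swap-rotate (take j zs) (drop j zs) (take m ys) (drop m ys) (take++drop≡id m ys)
  in k , trans e (cong (rotate k) (take++drop≡id j zs))

⊆-rotate⁻ : ∀ {s k xs} → s ⊆ rotate k xs → ∃₂ λ m s′ → s′ ⊆ xs × s ≡ rotate m s′
⊆-rotate⁻ {k = k} {xs} p with ⊆-++⁻ (drop k xs) (take k xs) p
... | s₁ , s₂ , refl , p₁ , p₂ =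
  length s₂ , s₂ ++ s₁ , subst (s₂ ++ s₁ ⊆_) (take++drop≡id k xs) (++⁺ p₂ p₁) , sym (rotate-++ s₂ s₁)

⊆-rotate⁺ : ∀ {s xs} → s ⊆ xs → ∀ m → ∃ λ k → rotate m s ⊆ rotate k xs
⊆-rotate⁺ {s} p m with ++-⊆⁻ (take m s) (drop m s) (subst (_⊆ _) (sym (take++drop≡id m s)) p)
... | xs₁ , xs₂ , refl , p₁ , p₂ = length xs₁ , subst (rotate m s ⊆_) (sym (rotate-++ xs₁ xs₂)) (++⁺ p₂ p₁)

IncreasingFrom : ℕ → (ℕ → ℕ) → Set
IncreasingFrom k f = ∀ {a b} → k ≤ a → a < b → f a < f b

increasing⇒<⇔ : ∀ {k f a b} → IncreasingFrom k f → k ≤ a → k ≤ b → (f a < f b ⇔ a < b)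
increasing⇒<⇔ {f = f} {a} {b} inc k≤a k≤b = mk⇔ reflect (inc k≤a)
  where
  reflect : f a < f b → a < b
  reflect fa<fb with <-cmp a b
  ... | tri< a<b _ _ = a<b
  ... | tri≈ _ refl _ = ⊥-elim (<-irrefl refl fa<fb)
  ... | tri> _ _ b<a = ⊥-elim (<-irrefl refl (<-trans fa<fb (inc k≤b b<a)))

countBelow : ℕ → List ℕ → ℕ
countBelow v xs = length (filter (_<? v) xs)

countBelow-∷ : ∀ {a b x y xs ys} → (x < a ⇔ y < b) → countBelow a xs ≡ countBelow b ys →
  countBelow a (x ∷ xs) ≡ countBelow b (y ∷ ys)
countBelow-∷ {a} {b} {x} {y} {xs} {ys} x<a⇔y<b eq with x <? a
... | yes x<a = begin
  countBelow a (x ∷ xs)   ≡⟨ cong length (filter-accept (_<? a) x<a) ⟩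
  suc (countBelow a xs)   ≡⟨ cong suc eq ⟩
  suc (countBelow b ys)   ≡⟨ cong length (filter-accept (_<? b) (Equivalence.to x<a⇔y<b x<a)) ⟨
  countBelow b (y ∷ ys)   ∎
  where open ≡-Reasoning
... | no x≮a = begin
  countBelow a (x ∷ xs)   ≡⟨ cong length (filter-reject (_<? a) x≮a) ⟩
  countBelow a xs         ≡⟨ eq ⟩
  countBelow b ys         ≡⟨ cong length (filter-reject (_<? b) (x≮a ∘ Equivalence.from x<a⇔y<b)) ⟨
  countBelow b (y ∷ ys)   ∎
  where open ≡-Reasoning

countBelow-≥ : ∀ {v xs} → All (v ≤_) xs → countBelow v xs ≡ 0
countBelow-≥ {v} v≤xs = cong length (filter-none (_<? v) (All.map ≤⇒≯ v≤xs))

countBelow-range : ∀ {v k n} → v ∈ range k n → k + countBelow v (range k n) ≡ v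
countBelow-range {k = k} {suc n} (here refl) =
  trans (cong (k +_) (countBelow-≥ (range-≥ k (suc n)))) (+-identityʳ k)
countBelow-range {v} {k} {suc n} (there v∈) = begin
  k + countBelow v (k ∷ range (suc k) n)     ≡⟨ cong (λ ys → k + length ys) (filter-accept (_<? v) k<v) ⟩
  k + suc (countBelow v (range (suc k) n))   ≡⟨ +-suc k _ ⟩
  suc k + countBelow v (range (suc k) n)     ≡⟨ countBelow-range v∈ ⟩
  v                                          ∎
  where
  open ≡-Reasoning
  k<v : k < v
  k<v = All.lookup (range-≥ (suc k) n) v∈

countBelow-perm : ∀ {v xs n} → xs ↭ range 1 n → v ∈ xs → suc (countBelow v xs) ≡ v
countBelow-perm {v} xs↭ v∈ =
  trans (cong suc (↭-length (filter-↭ (_<? v) xs↭))) (countBelow-range (∈-resp-↭ xs↭ v∈))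

countBelow-map : ∀ {k f v xs} → IncreasingFrom k f → All (k ≤_) xs → k ≤ v →
  countBelow (f v) (map f xs) ≡ countBelow v xs
countBelow-map inc []            k≤v = refl
countBelow-map inc (k≤x ∷ k≤xs) k≤v =
  countBelow-∷ (increasing⇒<⇔ inc k≤x k≤v) (countBelow-map inc k≤xs k≤v)

countBelow-cong : ∀ {a b} xs ys (eq : length xs ≡ length ys) →
  (∀ i → lookup xs i < a ⇔ lookup ys (cast eq i) < b) → countBelow a xs ≡ countBelow b ys
countBelow-cong []       []       _  _     = refl
countBelow-cong (x ∷ xs) (y ∷ ys) eq iso⇔ =
  countBelow-∷ (iso⇔ fzero) (countBelow-cong xs ys (suc-injective eq) (iso⇔ ∘ fsuc))

OrderIso-map : ∀ {k f xs} → IncreasingFrom k f → All (k ≤_) xs → OrderIso (map f xs) xs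
OrderIso-map {f = f} {xs} inc k≤xs = lm , λ i j →
  subst₂ (λ a b → a < b ⇔ lookup xs (cast lm i) < lookup xs (cast lm j))
    (sym (lookup-map f xs i)) (sym (lookup-map f xs j))
    (increasing⇒<⇔ inc (All.lookup k≤xs (∈-lookup _)) (All.lookup k≤xs (∈-lookup _)))
  where
  lm : length (map f xs) ≡ length xs
  lm = length-map f xs

OrderIso-map⇒≡ : ∀ {f xs ys m n} → IncreasingFrom 1 f → xs ↭ range 1 m → ys ↭ range 1 n →
  OrderIso (map f xs) ys → xs ≡ ys
OrderIso-map⇒≡ {f} {xs} {ys} inc xs↭ ys↭ (eq , iso) = lookup-ext xs ys (length-map f xs) eq lookups≡
  where
  lookups≡ : ∀ i → lookup xs (cast (length-map f xs) i) ≡ lookup ys (cast eq i)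
  lookups≡ i = begin
    x
      ≡⟨ countBelow-perm xs↭ (∈-lookup _) ⟨
    suc (countBelow x xs)
      ≡⟨ cong suc (countBelow-map inc 1≤xs (All.lookup 1≤xs (∈-lookup _))) ⟨
    suc (countBelow (f x) (map f xs))
      ≡⟨ cong (λ v → suc (countBelow v (map f xs))) (lookup-map f xs i) ⟨
    suc (countBelow (lookup (map f xs) i) (map f xs))
      ≡⟨ cong suc (countBelow-cong (map f xs) ys eq (λ j → iso j i)) ⟩
    suc (countBelow (lookup ys (cast eq i)) ys)
      ≡⟨ countBelow-perm ys↭ (∈-lookup _) ⟩
    lookup ys (cast eq i) ∎
    where
    open ≡-Reasoning
    x : ℕ
    x = lookup xs (cast (length-map f xs) i)
    1≤xs : All (1 ≤_) xs
    1≤xs = ↭-range-≥ xs↭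

ones zeros : ℕ → Word → List ℕ
ones  k r = proj₁ (split k r)
zeros k r = proj₂ (split k r)

ones-≥ : ∀ k r → All (k ≤_) (ones k r)
ones-≥ k []          = []
ones-≥ k (true ∷ r)  = ≤-refl ∷ All.map <⇒≤ (ones-≥ (suc k) r)
ones-≥ k (false ∷ r) = All.map <⇒≤ (ones-≥ (suc k) r)

zeros-≥ : ∀ k r → All (k ≤_) (zeros k r)
zeros-≥ k []          = []
zeros-≥ k (true ∷ r)  = All.map <⇒≤ (zeros-≥ (suc k) r)
zeros-≥ k (false ∷ r) = ≤-refl ∷ All.map <⇒≤ (zeros-≥ (suc k) r)

ones++zeros-↭ : ∀ k r → ones k r ++ zeros k r ↭ range k (length r)
ones++zeros-↭ k []          = ↭-refl
ones++zeros-↭ k (true ∷ r)  = prep k (ones++zeros-↭ (suc k) r)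
ones++zeros-↭ k (false ∷ r) =
  ↭-trans (shift k (ones (suc k) r) (zeros (suc k) r)) (prep k (ones++zeros-↭ (suc k) r))

ones-complement : ∀ k r → ones k (complement r) ≡ zeros k r
ones-complement k []          = refl
ones-complement k (true ∷ r)  = ones-complement (suc k) r
ones-complement k (false ∷ r) = cong (k ∷_) (ones-complement (suc k) r)

zeros-complement : ∀ k r → zeros k (complement r) ≡ ones k r
zeros-complement k []          = refl
zeros-complement k (true ∷ r)  = cong (k ∷_) (zeros-complement (suc k) r)
zeros-complement k (false ∷ r) = zeros-complement (suc k) r

Relabelling : ℕ → ℕ → (ℕ → ℕ) → Set
Relabelling k′ k f = IncreasingFrom k′ f × (∀ {a} → k′ ≤ a → k ≤ f a)

shift-relabelling : ∀ k′ k → Relabelling k′ k (_+ k)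
shift-relabelling k′ k = (λ _ a<b → +-monoˡ-< k a<b) , (λ {a} _ → m≤n+m k a)

relabelling-pred : ∀ {k′ k f} → Relabelling k′ (suc k) f → Relabelling k′ k f
relabelling-pred (inc , bound) = inc , <⇒≤ ∘ bound

extend : ℕ → ℕ → (ℕ → ℕ) → ℕ → ℕ
extend k′ k f a with a ≤? k′
... | yes _ = k
... | no  _ = f a

extend-at : ∀ k′ k f → extend k′ k f k′ ≡ k
extend-at k′ k f with k′ ≤? k′
... | yes _   = refl
... | no k′≰k′ = ⊥-elim (k′≰k′ ≤-refl)

extend-map : ∀ {k′ k f xs} → All (k′ <_) xs → map (extend k′ k f) xs ≡ map f xs
extend-map {k′} {k} {f} = map-cong-local ∘ All.map agrees
  where
  agrees : ∀ {a} → k′ < a → extend k′ k f a ≡ f a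
  agrees {a} k′<a with a ≤? k′
  ... | yes a≤k′ = ⊥-elim (<-irrefl refl (≤-<-trans a≤k′ k′<a))
  ... | no _     = refl

extend-relabelling : ∀ {k′ k f} → Relabelling (suc k′) (suc k) f → Relabelling k′ k (extend k′ k f)
extend-relabelling {k′} {k} {f} (inc , bound) = increasing , bounded
  where
  increasing : IncreasingFrom k′ (extend k′ k f)
  increasing {a} {b} k′≤a a<b with a ≤? k′ | b ≤? k′
  ... | yes _   | yes b≤k′ = ⊥-elim (<-irrefl refl (≤-<-trans b≤k′ (≤-<-trans k′≤a a<b)))
  ... | yes _   | no b≰k′  = bound (≰⇒> b≰k′)
  ... | no a≰k′ | yes b≤k′ = ⊥-elim (<-irrefl refl (<-≤-trans (<-trans (≰⇒> a≰k′) a<b) b≤k′))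
  ... | no a≰k′ | no _     = inc (≰⇒> a≰k′) a<b
  bounded : ∀ {a} → k′ ≤ a → k ≤ extend k′ k f a
  bounded {a} _ with a ≤? k′
  ... | yes _   = ≤-refl
  ... | no a≰k′ = <⇒≤ (bound (≰⇒> a≰k′))

-- f sends each value that split attaches to a letter of u to the value attached to that
-- letter in r.
split-⊆⁺ : ∀ {u r} → u ⊆ r → ∀ k k′ → ∃ λ f → Relabelling k′ k f ×
  map f (ones k′ u) ⊆ ones k r × map f (zeros k′ u) ⊆ zeros k r
split-⊆⁺ [] k k′ = (_+ k) , shift-relabelling k′ k , [] , []
split-⊆⁺ (true ∷ʳ p) k k′ with split-⊆⁺ p (suc k) k′
... | f , rel , q₁ , q₂ = f , relabelling-pred rel , k ∷ʳ q₁ , q₂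
split-⊆⁺ (false ∷ʳ p) k k′ with split-⊆⁺ p (suc k) k′
... | f , rel , q₁ , q₂ = f , relabelling-pred rel , q₁ , k ∷ʳ q₂
split-⊆⁺ {true ∷ u} (refl ∷ p) k k′ with split-⊆⁺ p (suc k) (suc k′)
... | f , rel , q₁ , q₂ = extend k′ k f , extend-relabelling rel ,
  extend-at k′ k f ∷ subst (_⊆ _) (sym (extend-map (ones-≥ (suc k′) u))) q₁ ,
  subst (_⊆ _) (sym (extend-map (zeros-≥ (suc k′) u))) q₂
split-⊆⁺ {false ∷ u} (refl ∷ p) k k′ with split-⊆⁺ p (suc k) (suc k′)
... | f , rel , q₁ , q₂ = extend k′ k f , extend-relabelling rel ,
  subst (_⊆ _) (sym (extend-map (ones-≥ (suc k′) u))) q₁ ,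
  extend-at k′ k f ∷ subst (_⊆ _) (sym (extend-map (zeros-≥ (suc k′) u))) q₂

split-⊆⁻ : ∀ r k {t₁ t₂} → t₁ ⊆ ones k r → t₂ ⊆ zeros k r → ∀ k′ →
  ∃ λ u → u ⊆ r × ∃ λ f → Relabelling k′ k f × map f (ones k′ u) ≡ t₁ × map f (zeros k′ u) ≡ t₂
split-⊆⁻ [] k [] [] k′ = [] , [] , (_+ k) , shift-relabelling k′ k , refl , refl
split-⊆⁻ (true ∷ r) k (_ ∷ʳ p₁) p₂ k′ with split-⊆⁻ r (suc k) p₁ p₂ k′
... | u , u⊆r , f , rel , e₁ , e₂ = u , true ∷ʳ u⊆r , f , relabelling-pred rel , e₁ , e₂
split-⊆⁻ (true ∷ r) k (refl ∷ p₁) p₂ k′ with split-⊆⁻ r (suc k) p₁ p₂ (suc k′)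
... | u , u⊆r , f , rel , e₁ , e₂ = true ∷ u , refl ∷ u⊆r , extend k′ k f , extend-relabelling rel ,
  cong₂ _∷_ (extend-at k′ k f) (trans (extend-map (ones-≥ (suc k′) u)) e₁) ,
  trans (extend-map (zeros-≥ (suc k′) u)) e₂
split-⊆⁻ (false ∷ r) k p₁ (_ ∷ʳ p₂) k′ with split-⊆⁻ r (suc k) p₁ p₂ k′
... | u , u⊆r , f , rel , e₁ , e₂ = u , false ∷ʳ u⊆r , f , relabelling-pred rel , e₁ , e₂
split-⊆⁻ (false ∷ r) k p₁ (refl ∷ p₂) k′ with split-⊆⁻ r (suc k) p₁ p₂ (suc k′)
... | u , u⊆r , f , rel , e₁ , e₂ = false ∷ u , refl ∷ u⊆r , extend k′ k f , extend-relabelling rel ,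
  trans (extend-map (ones-≥ (suc k′) u)) e₁ ,
  cong₂ _∷_ (extend-at k′ k f) (trans (extend-map (zeros-≥ (suc k′) u)) e₂)

oneDescentPerm-↭ : ∀ w → oneDescentPerm w ↭ range 1 (length w)
oneDescentPerm-↭ w =
  subst (λ n → oneDescentPerm w ↭ range 1 n) (length-reverse w) (ones++zeros-↭ 1 (reverse w))

oneDescentPerm-complement : ∀ w → CircEq (oneDescentPerm w) (oneDescentPerm (complement w))
oneDescentPerm-complement w = length Z , (begin
  O ++ Z                                      ≡⟨ rotate-++ Z O ⟨
  rotate (length Z) (Z ++ O)                  ≡⟨ cong (rotate (length Z)) complement-swaps ⟨
  rotate (length Z) (oneDescentPerm (complement w)) ∎)
  where
  open ≡-Reasoning
  O Z : List ℕ
  O = ones 1 (reverse w)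
  Z = zeros 1 (reverse w)
  complement-swaps : oneDescentPerm (complement w) ≡ Z ++ O
  complement-swaps =
    trans (cong (λ r → ones 1 r ++ zeros 1 r) (sym (reverse-map not w)))
          (cong₂ _++_ (ones-complement 1 (reverse w)) (zeros-complement 1 (reverse w)))

oneDescentPerm-⊆⁺ : ∀ {u w} → u ⊆ w →
  ∃ λ f → IncreasingFrom 1 f × map f (oneDescentPerm u) ⊆ oneDescentPerm w
oneDescentPerm-⊆⁺ {u} u⊆w with split-⊆⁺ (reverse⁺ u⊆w) 1 1
... | f , (inc , _) , q₁ , q₂ =
  f , inc , subst (_⊆ _) (sym (map-++ f (ones 1 (reverse u)) (zeros 1 (reverse u)))) (++⁺ q₁ q₂)

oneDescentPerm-⊆⁻ : ∀ {s w} → s ⊆ oneDescentPerm w →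
  ∃ λ u → u ⊆ w × ∃ λ f → IncreasingFrom 1 f × map f (oneDescentPerm u) ≡ s
oneDescentPerm-⊆⁻ {w = w} s⊆ with ⊆-++⁻ (ones 1 (reverse w)) (zeros 1 (reverse w)) s⊆
... | t₁ , t₂ , refl , p₁ , p₂ with split-⊆⁻ (reverse w) 1 p₁ p₂ 1
... | u , u⊆ , f , (inc , _) , e₁ , e₂ =
  reverse u , subst (reverse u ⊆_) (reverse-involutive w) (reverse⁺ u⊆) , f , inc , (begin
    map f (oneDescentPerm (reverse u))
      ≡⟨ cong (λ r → map f (ones 1 r ++ zeros 1 r)) (reverse-involutive u) ⟩
    map f (ones 1 u ++ zeros 1 u)
      ≡⟨ map-++ f (ones 1 u) (zeros 1 u) ⟩
    map f (ones 1 u) ++ map f (zeros 1 u)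
      ≡⟨ cong₂ _++_ e₁ e₂ ⟩
    t₁ ++ t₂ ∎)
  where open ≡-Reasoning

circContains⇒subword : ∀ {w τ} → IsPerm τ → CircContains (oneDescentPerm w) τ →
  ∃ λ u → u ⊆ w × CircEq τ (oneDescentPerm u)
circContains⇒subword {τ = τ} τ-perm (k , s , s⊆ , s≅τ) with ⊆-rotate⁻ {k = k} s⊆
... | m , s′ , s′⊆ , refl with oneDescentPerm-⊆⁻ s′⊆
... | u , u⊆w , f , inc , refl = u , u⊆w , m , sym (OrderIso-map⇒≡ inc
  (↭-trans (rotate-↭ m (oneDescentPerm u)) (oneDescentPerm-↭ u))
  (IsPerm⇒↭range τ-perm)
  (subst (λ xs → OrderIso xs τ) (rotate-map f m (oneDescentPerm u)) s≅τ))

subword⇒circContains : ∀ {u w τ} → IsPerm τ → u ⊆ w → CircEq τ (oneDescentPerm u) →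
  CircContains (oneDescentPerm w) τ
subword⇒circContains τ-perm u⊆w (m , refl) with oneDescentPerm-⊆⁺ u⊆w
... | f , inc , fu⊆w with ⊆-rotate⁺ fu⊆w m
... | k , sub =
  k , _ , subst (_⊆ _) (rotate-map f m _) sub , OrderIso-map inc (↭-range-≥ (IsPerm⇒↭range τ-perm))

singleRun : ∀ r → runsFrom true r ≡ 0 → ∃ λ j → r ≡ replicate j true
singleRun []         _ = 0 , refl
singleRun (true ∷ r) h with singleRun r h
... | j , refl = suc j , refl

twoRuns : ∀ r → runsFrom false r ≤ 1 → ∃₂ λ i j → r ≡ replicate i false ++ replicate j true
twoRuns []          _ = 0 , 0 , refl
twoRuns (false ∷ r) h with twoRuns r h
... | i , j , refl = suc i , j , refl
twoRuns (true ∷ r)  h with singleRun r (n≤0⇒n≡0 (s≤s⁻¹ h))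
... | j , refl = 0 , suc j , refl

ones++zeros-sorted : ∀ k j i → let r = replicate j true ++ replicate i false in
  ones k r ++ zeros k r ≡ range k (length r)
ones++zeros-sorted k zero    i = cong₂ _++_ (onesFalse k i) (zerosFalse k i)
  where
  onesFalse : ∀ k i → ones k (replicate i false) ≡ []
  onesFalse k zero    = refl
  onesFalse k (suc i) = onesFalse (suc k) i
  zerosFalse : ∀ k i → zeros k (replicate i false) ≡ range k (length (replicate i false))
  zerosFalse k zero    = refl
  zerosFalse k (suc i) = cong (k ∷_) (zerosFalse (suc k) i)
ones++zeros-sorted k (suc j) i = cong (k ∷_) (ones++zeros-sorted (suc k) j i)

identityPerm≡oneDescentPerm : ∀ i j → let w = replicate i false ++ replicate j true in
  identityPerm (length w) ≡ oneDescentPerm w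
identityPerm≡oneDescentPerm i j = begin
  identityPerm (length w)       ≡⟨ identityPerm≡range (length w) ⟩
  range 1 (length w)            ≡⟨ cong (range 1) (length-reverse w) ⟨
  range 1 (length (reverse w))  ≡⟨ subst (λ r → ones 1 r ++ zeros 1 r ≡ range 1 (length r))
                                           (sym reverse-w) (ones++zeros-sorted 1 j i) ⟨
  oneDescentPerm w              ∎
  where
  open ≡-Reasoning
  w : Word
  w = replicate i false ++ replicate j true
  reverse-w : reverse w ≡ replicate j true ++ replicate i false
  reverse-w = trans (reverse-++ (replicate i false) (replicate j true))
                    (cong₂ _++_ (reverse-replicate j true) (reverse-replicate i false))

G≡oneDescentPerm : ∀ {w} → StartsWith0 w → G w ≡ oneDescentPerm w
G≡oneDescentPerm {w} _ with 3 ≤? runs w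
... | yes _ = refl
G≡oneDescentPerm {false ∷ r} refl | no ¬3≤runs with twoRuns r (s≤s⁻¹ (s≤s⁻¹ (≰⇒> ¬3≤runs)))
... | i , j , refl = identityPerm≡oneDescentPerm (suc i) j

complement-involutive : ∀ w → complement (complement w) ≡ w
complement-involutive w = trans (sym (map-∘ w)) (trans (map-cong not-involutive w) (map-id w))

theorem5p10 : (w₁ : Word) → StartsWith0 w₁ → 3 ≤ runs w₁ →
    (τ : List ℕ) → IsPerm τ → 0 < length τ →
    CircContains (G w₁) τ ⇔
      ∃ λ (w₂ : Word) → StartsWith0 w₂ × (w₂ ⊆ w₁ ⊎ complement w₂ ⊆ w₁) × CircEq τ (G w₂)
theorem5p10 w₁ w₁-0 _ τ τ-perm τ-nonempty = mk⇔ forward backward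
  where
  G-w₁ : G w₁ ≡ oneDescentPerm w₁
  G-w₁ = G≡oneDescentPerm w₁-0

  Witness : Set
  Witness = ∃ λ w₂ → StartsWith0 w₂ × (w₂ ⊆ w₁ ⊎ complement w₂ ⊆ w₁) × CircEq τ (G w₂)

  startWith0 : ∀ {u} → u ⊆ w₁ → CircEq τ (oneDescentPerm u) → Witness
  startWith0 {[]}        _    (m , refl) = ⊥-elim (<-irrefl (sym (↭-length (rotate-↭ m []))) τ-nonempty)
  startWith0 {false ∷ u} u⊆w₁ τ≈u        =
    false ∷ u , refl , inj₁ u⊆w₁ , subst (CircEq τ) (sym (G≡oneDescentPerm {false ∷ u} refl)) τ≈u
  startWith0 {true ∷ u}  u⊆w₁ τ≈u        =
    complement (true ∷ u) , refl , inj₂ (subst (_⊆ w₁) (sym (complement-involutive (true ∷ u))) u⊆w₁) ,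
    subst (CircEq τ) (sym (G≡oneDescentPerm {complement (true ∷ u)} refl))
      (CircEq-trans τ≈u (oneDescentPerm-complement (true ∷ u)))

  forward : CircContains (G w₁) τ → Witness
  forward contains with circContains⇒subword τ-perm (subst (λ σ → CircContains σ τ) G-w₁ contains)
  ... | u , u⊆w₁ , τ≈u = startWith0 u⊆w₁ τ≈u

  backward : Witness → CircContains (G w₁) τ
  backward (w₂ , w₂-0 , w₂⊆w₁ , τ≈w₂) = subst (λ σ → CircContains σ τ) (sym G-w₁) (contained w₂⊆w₁)
    where
    τ≈odp : CircEq τ (oneDescentPerm w₂)
    τ≈odp = subst (CircEq τ) (G≡oneDescentPerm w₂-0) τ≈w₂
    contained : w₂ ⊆ w₁ ⊎ complement w₂ ⊆ w₁ → CircContains (oneDescentPerm w₁) τ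
    contained (inj₁ w₂⊆w₁)  = subword⇒circContains τ-perm w₂⊆w₁ τ≈odp
    contained (inj₂ w₂ᶜ⊆w₁) =
      subword⇒circContains τ-perm w₂ᶜ⊆w₁ (CircEq-trans τ≈odp (oneDescentPerm-complement w₂))
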